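{- Let $\Sigma_{\mathrm U}=\Sigma_{\mathrm{UFD}}\cup\Sigma_{\mathrm{UID}}$ be a set of unary FDs and UIDs closed under finite implication. For any non-trivial SCC $P$ of $\Gamma(\Sigma_{\mathrm{UID}})$, the set $P\cup P^{ -1}$ is transitively closed, where $P^{ -1}=\{\tau^{ -1}:\tau\in P\}$.
   Context: A UID $R^p\subseteq S^q$ ($R^p\ne S^q$) says every element at $R^p$ occurs at $S^q$; its reverse $\tau^{ -1}$ is $S^q\subseteq R^p$. A unary FD $R^i\to R^j$ says two $R$-facts agreeing on $R^i$ agree on $R^j$. Closed under finite implication: contains every UID and UFD satisfied by all finite instances satisfying $\Sigma_{\mathrm U}$. A set of UIDs is transitively closed if $R^p\subseteq S^q$ and $S^q\subseteq T^r$ in it with $R^p\neq T^r$ imply $R^p\subseteq T^r$ in it. For $\tau:R^p\subseteq S^q$, $\tau':S^r\subseteq T^u$ in $\Sigma_{\mathrm{UID}}$, $\tau\rightarrowtail\tau'$ iff $S^r\neq S^q$ and $S^r\to S^q\in\Sigma_{\mathrm{UFD}}$. $\Gamma(\Sigma_{\mathrm{UID}})$ is the directed graph on $\Sigma_{\mathrm{UID}}$ with edges $\rightarrowtail$; SCCs are maximal sets $P$ with $\tau\rightarrowtail^*\tau'$ for all $\tau,\tau'\in P$; an SCC is non-trivial unless it is a singleton $\{\tau\}$ with $\tau\not\rightarrowtail\tau$. -}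

module Defs where

open import Data.Nat using (ℕ)
open import Data.Fin using (Fin)
open import Data.Vec using (Vec; lookup)
open import Data.List using (List)
open import Data.List.Relation.Unary.All using (All)
open import Data.List.Membership.Propositional using (_∈_)
open import Data.Product using (Σ; ∃; ∃-syntax; _×_; _,_; proj₁; proj₂)
open import Data.Sum using (_⊎_)
open import Relation.Binary.PropositionalEquality using (_≡_; _≢_)
open import Relation.Nullary using (¬_)
open import Relation.Binary.Construct.Closure.ReflexiveTransitive using (Star)

module Schema (n : ℕ) (ar : Fin n → ℕ) where

  Position : Set
  Position = Σ (Fin n) (λ R → Fin (ar R))

  record UID : Set where
    constructor _⊆ᵤ_
    field
      lhs : Position
      rhs : Position
  open UID public

  record UFD : Set where
    constructor ufd
    field
      rel  : Fin n
      from : Fin (ar rel)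
      to   : Fin (ar rel)

  _⁻¹ : UID → UID
  (a ⊆ᵤ b) ⁻¹ = b ⊆ᵤ a

  -- finite instances: each relation has a finite list of facts (tuples)
  Instance : Set
  Instance = (R : Fin n) → List (Vec ℕ (ar R))

  _⊨ᵢ_ : Instance → UID → Set
  I ⊨ᵢ ((R , p) ⊆ᵤ (S , q)) =
    ∀ f → f ∈ I R → ∃[ g ] (g ∈ I S × lookup g q ≡ lookup f p)

  _⊨f_ : Instance → UFD → Set
  I ⊨f (ufd R i j) =
    ∀ f g → f ∈ I R → g ∈ I R → lookup f i ≡ lookup g i → lookup f j ≡ lookup g j

  -- A set Σ_U = Σ_UFD ∪ Σ_UID (finite, as the schema is finite).
  record Constraints : Set where
    constructor mkΣ
    field
      uids : List UID
      ufds : List UFD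

  module _ (ΣU : Constraints) where
    open Constraints ΣU

    ProperUIDs : Set
    ProperUIDs = All (λ τ → lhs τ ≢ rhs τ) uids

    _⊨Σ_ : Instance → Constraints → Set
    I ⊨Σ c = All (I ⊨ᵢ_) (Constraints.uids c) × All (I ⊨f_) (Constraints.ufds c)

    ClosedFinImpl : Set
    ClosedFinImpl =
      (∀ (τ : UID) → lhs τ ≢ rhs τ → (∀ (I : Instance) → I ⊨Σ ΣU → I ⊨ᵢ τ) → τ ∈ uids)
      × (∀ (φ : UFD) → (∀ (I : Instance) → I ⊨Σ ΣU → I ⊨f φ) → φ ∈ ufds)

    _↣_ : UID → UID → Set
    τ ↣ τ' = τ ∈ uids × τ' ∈ uids ×
      ∃[ r ] (lhs τ' ≡ (proj₁ (rhs τ) , r) × lhs τ' ≢ rhs τ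
              × ufd (proj₁ (rhs τ)) r (proj₂ (rhs τ)) ∈ ufds)

    _↣*_ : UID → UID → Set
    _↣*_ = Star _↣_

    IsSCC : List UID → Set
    IsSCC P =
      (∀ τ → τ ∈ P → τ ∈ uids)
      × (∃[ τ ] τ ∈ P)
      × (∀ τ τ' → τ ∈ P → τ' ∈ P → τ ↣* τ')
      × (∀ τ τ' → τ ∈ P → τ' ∈ uids → τ ↣* τ' → τ' ↣* τ → τ' ∈ P)

    NonTrivial : List UID → Set
    NonTrivial P = ¬ (∃[ τ ] ((∀ τ' → τ' ∈ P → τ' ≡ τ) × τ ∈ P × ¬ (τ ↣ τ)))

  _∈P∪P⁻¹_ : UID → List UID → Set
  τ ∈P∪P⁻¹ P = τ ∈ P ⊎ (τ ⁻¹) ∈ P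

  TransClosed : (UID → Set) → Set
  TransClosed Q = ∀ (a b c : Position) → Q (a ⊆ᵤ b) → Q (b ⊆ᵤ c) → a ≢ c → Q (a ⊆ᵤ c)

module Submission where

-- Write card I x for the number of distinct values at a
-- position x in a finite instance I.  A UID x ⊆ y forces card x ≤ card y and a
-- UFD i → j forces card j ≤ card i, so along an edge R^p ⊆ S^q ↣ S^r ⊆ T^u of
-- Γ(Σ_UID) we get card R^p ≤ card S^q ≤ card S^r.  Around the cycles of a
-- non-trivial SCC P these inequalities are equalities in every finite model;
-- by the pigeonhole principle every UID of P, and every dependency witnessing
-- an edge inside P, then holds reversed, and closure under finite implication
-- puts the reverses into Σ_U.  Transitivity of P ∪ P⁻¹ splits into four cases:
-- chaining two UIDs of P stays in P; if two UIDs of P share a position, a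
-- lockstep walk along the cycles of P finds branching nodes, which give paths
-- from P to P⁻¹ and back, so P⁻¹ = P and the first case applies.

open import Data.Nat using (ℕ; suc; _≤_; _<_; _+_; z≤n; s≤s)
import Data.Nat as ℕ
open import Data.Fin using (Fin)
import Data.Fin as Fin
open import Data.Vec using (lookup)
open import Data.Nat.Properties
  using (≤-refl; ≤-trans; ≤-reflexive; ≤-antisym; n≤1+n; n<1+n; m<n⇒m<1+n; <-irrefl; <-≤-trans;
         +-monoʳ-<; +-monoˡ-<; module ≤-Reasoning)
open import Data.List using (List; []; _∷_; map; filter)
open import Data.List.Properties using (filter-all)
open import Data.List.Membership.Propositional using (_∈_; _∉_)
open import Data.List.Membership.Propositional.Properties using (∈-map⁺; ∈-map⁻; ∈-filter⁺; ∈-filter⁻)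
open import Data.List.Relation.Binary.Subset.Propositional using (_⊆_)
open import Data.List.Relation.Unary.Any using (here; there)
open import Data.List.Relation.Unary.All.Properties using (¬Any⇒All¬)
import Data.List.Relation.Unary.All as All
open import Data.Product using (∃; _×_; _,_; proj₁; proj₂; uncurry)
import Data.Product as Prod
open import Data.Product.Properties using (≡-dec)
open import Data.Sum using (_⊎_; inj₁; inj₂)
import Data.Sum as Sum
open import Data.Empty using (⊥; ⊥-elim)
open import Function using (_∘_; id; flip)
open import Level using (0ℓ)
open import Effect.Monad using (RawMonad)
open import Relation.Nullary.Negation using (¬¬-Monad)
open import Relation.Nullary.Decidable using (decidable-stable; _⊎-dec_)
open import Relation.Nullary using (¬_; yes; no; ¬?)
open import Relation.Binary.Definitions using (DecidableEquality)
open import Relation.Binary.Construct.Closure.ReflexiveTransitive using (Star; ε; _◅_; _◅◅_; gmap)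
import Relation.Binary.Construct.Closure.ReflexiveTransitive as Star
open import Relation.Binary.PropositionalEquality using (_≡_; _≢_; refl; sym; trans; cong; subst)
open import Defs

-- Non-triviality of P is a negative statement, so the existence of successors
-- is only available under double negation; the argument runs in the
-- double-negation monad and escapes it at the end by decidability.
open RawMonad (¬¬-Monad {a = 0ℓ})

module DistinctCount {A : Set} (_≟_ : DecidableEquality A) where
  open import Data.List.Membership.DecPropositional _≟_ using (_∈?_)

  count : List A → ℕ
  count []       = 0
  count (x ∷ xs) with x ∈? xs
  ... | yes _ = count xs
  ... | no  _ = suc (count xs)

  count-∈ : ∀ {x xs} → x ∈ xs → count (x ∷ xs) ≡ count xs
  count-∈ {x} {xs} x∈xs with x ∈? xs
  ... | yes _    = refl
  ... | no  x∉xs = ⊥-elim (x∉xs x∈xs)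

  count-∉ : ∀ {x xs} → x ∉ xs → count (x ∷ xs) ≡ suc (count xs)
  count-∉ {x} {xs} x∉xs with x ∈? xs
  ... | yes x∈xs = ⊥-elim (x∉xs x∈xs)
  ... | no  _    = refl

  count-∷-≤ : ∀ x xs → count (x ∷ xs) ≤ suc (count xs)
  count-∷-≤ x xs with x ∈? xs
  ... | yes _ = n≤1+n (count xs)
  ... | no  _ = ≤-refl

  remove : A → List A → List A
  remove x = filter (λ y → ¬? (x ≟ y))

  count-remove : ∀ {x} ys → x ∈ ys → count ys ≡ suc (count (remove x ys))
  count-remove {x} (y ∷ ys) x∈ with x ≟ y
  count-remove {x} (.x ∷ ys) x∈ | yes refl with x ∈? ys
  ... | yes x∈ys = count-remove ys x∈ys
  ... | no  x∉ys =
    cong suc (cong count (sym (filter-all (λ y → ¬? (x ≟ y)) (¬Any⇒All¬ ys x∉ys))))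
  count-remove {x} (y ∷ ys) (here x≡y)   | no x≢y = ⊥-elim (x≢y x≡y)
  count-remove {x} (y ∷ ys) (there x∈ys) | no x≢y with y ∈? ys | y ∈? remove x ys
  ... | yes _    | yes _   = count-remove ys x∈ys
  ... | no  _    | no  _   = cong suc (count-remove ys x∈ys)
  ... | yes y∈ys | no  y∉r = ⊥-elim (y∉r (∈-filter⁺ (λ y → ¬? (x ≟ y)) y∈ys x≢y))
  ... | no  y∉ys | yes y∈r = ⊥-elim (y∉ys (proj₁ (∈-filter⁻ (λ y → ¬? (x ≟ y)) y∈r)))

  count-mono : ∀ xs ys → xs ⊆ ys → count xs ≤ count ys
  count-mono []       ys xs⊆ys = z≤n
  count-mono (x ∷ xs) ys x∷xs⊆ys with x ∈? xs
  ... | yes _    = count-mono xs ys (x∷xs⊆ys ∘ there)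
  ... | no  x∉xs = begin
      suc (count xs)              ≤⟨ s≤s (count-mono xs (remove x ys) xs⊆rest) ⟩
      suc (count (remove x ys))   ≡⟨ sym (count-remove ys (x∷xs⊆ys (here refl))) ⟩
      count ys                    ∎
    where
      open ≤-Reasoning
      xs⊆rest : xs ⊆ remove x ys
      xs⊆rest {y} y∈xs = ∈-filter⁺ (λ y → ¬? (x ≟ y)) (x∷xs⊆ys (there y∈xs))
                           (λ { refl → x∉xs y∈xs })

  count-⊆-reverse : ∀ xs ys → xs ⊆ ys → count ys ≤ count xs → ys ⊆ xs
  count-⊆-reverse xs ys xs⊆ys ys≤xs {y} y∈ys with y ∈? xs
  ... | yes y∈xs = y∈xs
  ... | no  y∉xs = ⊥-elim (<-irrefl refl (begin-strict
      count xs         <⟨ s≤s ≤-refl ⟩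
      suc (count xs)   ≡⟨ sym (count-∉ y∉xs) ⟩
      count (y ∷ xs)   ≤⟨ count-mono (y ∷ xs) ys (λ { (here refl) → y∈ys ; (there z∈) → xs⊆ys z∈ }) ⟩
      count ys         ≤⟨ ys≤xs ⟩
      count xs         ∎))
    where open ≤-Reasoning

  module _ {B : Set} where

    Determines : (B → A) → (B → A) → List B → Set
    Determines α β F = ∀ f g → f ∈ F → g ∈ F → α f ≡ α g → β f ≡ β g

    restrict : ∀ {α β f F} → Determines α β (f ∷ F) → Determines α β F
    restrict α→β f g f∈ g∈ = α→β f g (there f∈) (there g∈)

    count-determined : ∀ α β F → Determines α β F → count (map β F) ≤ count (map α F)
    count-determined α β []      α→β = z≤n
    count-determined α β (f ∷ F) α→β with α f ∈? map α F
    ... | yes αf∈ with ∈-map⁻ α αf∈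
    ...   | g , g∈F , αf≡αg = begin
        count (β f ∷ map β F)   ≡⟨ count-∈ (subst (_∈ map β F) (sym βf≡βg) (∈-map⁺ β g∈F)) ⟩
        count (map β F)         ≤⟨ count-determined α β F (restrict α→β) ⟩
        count (map α F)         ∎
      where
        open ≤-Reasoning
        βf≡βg : β f ≡ β g
        βf≡βg = α→β f g (here refl) (there g∈F) αf≡αg
    count-determined α β (f ∷ F) α→β | no _ = begin
        count (β f ∷ map β F)   ≤⟨ count-∷-≤ (β f) (map β F) ⟩
        suc (count (map β F))   ≤⟨ s≤s (count-determined α β F (restrict α→β)) ⟩
        suc (count (map α F))   ∎
      where open ≤-Reasoning

    twin-extends : ∀ {α β f g F} → g ∈ F → α f ≡ α g → β f ≡ β g →
                   Determines β α F → Determines β α (f ∷ F)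
    twin-extends g∈F αf≡αg βf≡βg β→α _ _ (here refl) (here refl) _ = refl
    twin-extends g∈F αf≡αg βf≡βg β→α _ y (here refl) (there y∈) e =
      trans αf≡αg (β→α _ y g∈F y∈ (trans (sym βf≡βg) e))
    twin-extends g∈F αf≡αg βf≡βg β→α x _ (there x∈) (here refl) e =
      trans (β→α x _ x∈ g∈F (trans e βf≡βg)) (sym αf≡αg)
    twin-extends g∈F αf≡αg βf≡βg β→α x y (there x∈) (there y∈) e = β→α x y x∈ y∈ e

    fresh-extends : ∀ {α β f F} → β f ∉ map β F →
                    Determines β α F → Determines β α (f ∷ F)
    fresh-extends βf∉ β→α _ _ (here refl) (here refl) _ = refl
    fresh-extends {β = β} {F = F} βf∉ β→α _ y (here refl) (there y∈) e =
      ⊥-elim (βf∉ (subst (_∈ map β F) (sym e) (∈-map⁺ β y∈)))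
    fresh-extends {β = β} {F = F} βf∉ β→α x _ (there x∈) (here refl) e =
      ⊥-elim (βf∉ (subst (_∈ map β F) e (∈-map⁺ β x∈)))
    fresh-extends βf∉ β→α x y (there x∈) (there y∈) e = β→α x y x∈ y∈ e

    -- By induction:
    -- the head record either has a twin in the tail or brings a new α value,
    -- and then (counts being balanced) also a new β value.
    determined-converse : ∀ α β F → Determines α β F →
                          count (map α F) ≤ count (map β F) → Determines β α F
    determined-converse α β []      α→β α≤β x y ()
    determined-converse α β (f ∷ F) α→β α≤β with α f ∈? map α F | β f ∈? map β F
    ... | yes αf∈ | yes _ with ∈-map⁻ α αf∈
    ...   | g , g∈F , αf≡αg = twin-extends g∈F αf≡αg (α→β f g (here refl) (there g∈F) αf≡αg)
                                (determined-converse α β F (restrict α→β) α≤β)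
    determined-converse α β (f ∷ F) α→β α≤β | yes αf∈ | no βf∉ with ∈-map⁻ α αf∈
    ...   | g , g∈F , αf≡αg = ⊥-elim (βf∉ (subst (_∈ map β F)
                                (sym (α→β f g (here refl) (there g∈F) αf≡αg)) (∈-map⁺ β g∈F)))
    determined-converse α β (f ∷ F) α→β α≤β | no _ | yes _ =
      ⊥-elim (<-irrefl refl (≤-trans α≤β (count-determined α β F (restrict α→β))))
    determined-converse α β (f ∷ F) α→β (s≤s α≤β) | no _ | no βf∉ =
      fresh-extends βf∉ (determined-converse α β F (restrict α→β) α≤β)

module Successors {A : Set} (R : A → A → Set) where

  Functional : Set
  Functional = ∀ {m u v} → R m u → R m v → u ≡ v

  Branching : Set
  Branching = ∃ λ m → ∃ λ u → ∃ λ v → R m u × R m v × u ≢ v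

  steps : ∀ {x y} → Star R x y → ℕ
  steps ε       = 0
  steps (_ ◅ π) = suc (steps π)

  last-step : ∀ {x y z} → R x y → Star R y z → ∃ λ m → R m z
  last-step e ε        = _ , e
  last-step _ (e ◅ π)  = last-step e π

  module _ (functional : Functional) {a c s} (a→s : R a s) (c→s : R c s) (a≢c : a ≢ c) where

    -- Walk two paths from a common node in lockstep.  Since successors are
    -- unique, the walks agree until one of them ends, say in a; the other
    -- walk then continues with the unique successor s of a, which leaves a
    -- strictly shorter path from s to c.
    shortcut : ∀ {x} (π : Star R x a) (ρ : Star R x c) →
               (∃ λ (ρ′ : Star R s c) → steps ρ′ < steps ρ) ⊎
               (∃ λ (π′ : Star R s a) → steps π′ < steps π)
    shortcut ε       ε        = ⊥-elim (a≢c refl)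
    shortcut ε       (e ◅ ρ) with functional e a→s
    ... | refl = inj₁ (ρ , n<1+n (steps ρ))
    shortcut (e ◅ π) ε       with functional e c→s
    ... | refl = inj₂ (π , n<1+n (steps π))
    shortcut (e ◅ π) (e′ ◅ ρ) with functional e e′
    ... | refl = Sum.map (Prod.map₂ m<n⇒m<1+n) (Prod.map₂ m<n⇒m<1+n) (shortcut π ρ)

    -- Hence paths from s back to both a and c cannot coexist; the fuel k
    -- bounds their total length.
    no-common-cycle : ∀ k (π : Star R s a) (ρ : Star R s c) → steps π + steps ρ < k → ⊥
    no-common-cycle (suc k) π ρ (s≤s π+ρ<k) with shortcut π ρ
    ... | inj₁ (ρ′ , ρ′<ρ) = no-common-cycle k π ρ′ (<-≤-trans (+-monoʳ-< (steps π) ρ′<ρ) π+ρ<k)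
    ... | inj₂ (π′ , π′<π) = no-common-cycle k π′ ρ (<-≤-trans (+-monoˡ-< (steps ρ) π′<π) π+ρ<k)

  cycle-branches : DecidableEquality A → ∀ {a c s} → a ≢ c → R a s → R c s →
                   Star R s a → Star R s c → ¬ ¬ Branching
  cycle-branches _≟_ a≢c a→s c→s π ρ ¬branching =
    no-common-cycle functional a→s c→s a≢c (suc (steps π + steps ρ)) π ρ ≤-refl
    where
      functional : Functional
      functional {m} {u} {v} m→u m→v with u ≟ v
      ... | yes u≡v = u≡v
      ... | no  u≢v = ⊥-elim (¬branching (m , u , v , m→u , m→v , u≢v))

open Successors using (last-step; cycle-branches)

module UnaryConstraints (n : ℕ) (ar : Fin n → ℕ) where
  open Schema n ar
  open DistinctCount ℕ._≟_

  _≟ₚ_ : DecidableEquality Position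
  _≟ₚ_ = ≡-dec Fin._≟_ Fin._≟_

  _≟ᵤ_ : DecidableEquality UID
  (a ⊆ᵤ b) ≟ᵤ (c ⊆ᵤ d) with a ≟ₚ c | b ≟ₚ d
  ... | yes refl | yes refl = yes refl
  ... | no  a≢c  | _        = no (λ e → a≢c (cong lhs e))
  ... | _        | no  b≢d  = no (λ e → b≢d (cong rhs e))

  values : Instance → Position → List ℕ
  values I (R , p) = map (λ f → lookup f p) (I R)

  card : Instance → Position → ℕ
  card I x = count (values I x)

  ⊨⇒⊆ : ∀ I x y → I ⊨ᵢ (x ⊆ᵤ y) → values I x ⊆ values I y
  ⊨⇒⊆ I (R , p) (S , q) x⊆y v∈x with ∈-map⁻ (λ f → lookup f p) v∈x
  ... | f , f∈ , refl with x⊆y f f∈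
  ...   | g , g∈ , gq≡fp = subst (_∈ values I (S , q)) gq≡fp (∈-map⁺ (λ g → lookup g q) g∈)

  ⊆⇒⊨ : ∀ I x y → values I x ⊆ values I y → I ⊨ᵢ (x ⊆ᵤ y)
  ⊆⇒⊨ I (R , p) (S , q) x⊆y f f∈ with ∈-map⁻ (λ g → lookup g q) (x⊆y (∈-map⁺ (λ f → lookup f p) f∈))
  ... | g , g∈ , fp≡gq = g , g∈ , sym fp≡gq

  module Implication (ΣU : Constraints) (proper : ProperUIDs ΣU) (closed : ClosedFinImpl ΣU) where
    open Constraints ΣU

    Model : Instance → Set
    Model I = _⊨Σ_ ΣU I ΣU

    uid-holds : ∀ {I τ} → Model I → τ ∈ uids → I ⊨ᵢ τ
    uid-holds M = All.lookup (proj₁ M)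

    ufd-holds : ∀ {I φ} → Model I → φ ∈ ufds → I ⊨f φ
    ufd-holds M = All.lookup (proj₂ M)

    uid-trans : ∀ {x y z} → (x ⊆ᵤ y) ∈ uids → (y ⊆ᵤ z) ∈ uids → x ≢ z → (x ⊆ᵤ z) ∈ uids
    uid-trans {x} {y} {z} xy yz x≢z = proj₁ closed _ x≢z λ I M →
      ⊆⇒⊨ I x z (⊨⇒⊆ I y z (uid-holds M yz) ∘ ⊨⇒⊆ I x y (uid-holds M xy))

    ufd-trans : ∀ {R i j k} → ufd R i j ∈ ufds → ufd R j k ∈ ufds → ufd R i k ∈ ufds
    ufd-trans ij jk = proj₂ closed _ λ I M f g f∈ g∈ →
      ufd-holds M jk f g f∈ g∈ ∘ ufd-holds M ij f g f∈ g∈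

    uid-converse : ∀ {x y} → (x ⊆ᵤ y) ∈ uids → (∀ I → Model I → card I y ≤ card I x) → (y ⊆ᵤ x) ∈ uids
    uid-converse {x} {y} xy y≤x = proj₁ closed _ (λ y≡x → All.lookup proper xy (sym y≡x)) λ I M →
      ⊆⇒⊨ I y x (count-⊆-reverse (values I x) (values I y) (⊨⇒⊆ I x y (uid-holds M xy)) (y≤x I M))

    ufd-converse : ∀ {R i j} → ufd R i j ∈ ufds → (∀ I → Model I → card I (R , i) ≤ card I (R , j)) →
                   ufd R j i ∈ ufds
    ufd-converse {R} ij i≤j = proj₂ closed _ λ I M →
      determined-converse _ _ (I R) (ufd-holds M ij) (i≤j I M)

    _⟶_ : UID → UID → Set
    _⟶_ = _↣_ ΣU

    _⟶*_ : UID → UID → Set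
    _⟶*_ = Star _⟶_

    edge : ∀ {x S q r y} → (x ⊆ᵤ (S , q)) ∈ uids → ((S , r) ⊆ᵤ y) ∈ uids →
           (S , r) ≢ (S , q) → ufd S r q ∈ ufds → (x ⊆ᵤ (S , q)) ⟶ ((S , r) ⊆ᵤ y)
    edge xΣ yΣ r≢q r→q = xΣ , yΣ , _ , refl , r≢q , r→q

    ⟶-source : ∀ {a a′ b τ} → (a ⊆ᵤ b) ⟶ τ → (a′ ⊆ᵤ b) ∈ uids → (a′ ⊆ᵤ b) ⟶ τ
    ⟶-source (_ , τΣ , r , eq , ne , fd) a′bΣ = a′bΣ , τΣ , r , eq , ne , fd

    ⟶-target : ∀ {a b b′ τ} → τ ⟶ (a ⊆ᵤ b) → (a ⊆ᵤ b′) ∈ uids → τ ⟶ (a ⊆ᵤ b′)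
    ⟶-target (τΣ , _ , r , eq , ne , fd) ab′Σ = τΣ , ab′Σ , r , eq , ne , fd

    -- Along an edge x ⟶ y the number of values cannot decrease:
    -- lhs x ⊆ rhs x is a UID and lhs y → rhs x is a UFD.
    edge-card : ∀ {I x y} → Model I → x ⟶ y →
                card I (lhs x) ≤ card I (rhs x) × card I (rhs x) ≤ card I (lhs y)
    edge-card {I} {(R , p) ⊆ᵤ (S , q)} M (xΣ , _ , r , refl , _ , r→q) =
      count-mono (values I (R , p)) (values I (S , q)) (⊨⇒⊆ I (R , p) (S , q) (uid-holds M xΣ)) ,
      count-determined _ _ (I S) (ufd-holds M r→q)

    path-card : ∀ {I x y} → Model I → x ⟶* y → card I (lhs x) ≤ card I (lhs y)
    path-card M ε       = ≤-refl
    path-card M (e ◅ π) = ≤-trans (uncurry ≤-trans (edge-card M e)) (path-card M π)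

    module Component (P : List UID) (scc : IsSCC ΣU P) (nontrivial : NonTrivial ΣU P) where

      inΣ : ∀ {τ} → τ ∈ P → τ ∈ uids
      inΣ {τ} = proj₁ scc τ

      connected : ∀ {τ τ′} → τ ∈ P → τ′ ∈ P → τ ⟶* τ′
      connected {τ} {τ′} = proj₁ (proj₂ (proj₂ scc)) τ τ′

      maximal : ∀ {τ τ′} → τ ∈ P → τ ⟶* τ′ → τ′ ⟶* τ → τ′ ∈ uids → τ′ ∈ P
      maximal {τ} {τ′} τP forth back τ′Σ = proj₂ (proj₂ (proj₂ scc)) τ τ′ τP τ′Σ forth back

      record _⟶ₚ_ (x y : UID) : Set where
        constructor step
        field
          source∈P : x ∈ P
          target∈P : y ∈ P
          edge-of  : x ⟶ y
      open _⟶ₚ_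

      forget : ∀ {x y} → Star _⟶ₚ_ x y → x ⟶* y
      forget = gmap id edge-of

      -- By maximality, a path between members of P stays inside P.
      connectedₚ : ∀ {τ τ′} → τ ∈ P → τ′ ∈ P → Star _⟶ₚ_ τ τ′
      connectedₚ τP τ′P = inside τP (connected τP τ′P)
        where
          inside : ∀ {x} → x ∈ P → x ⟶* _ → Star _⟶ₚ_ x _
          inside xP ε       = ε
          inside xP (e ◅ π) = step xP yP e ◅ inside yP π
            where yP = maximal xP (e ◅ ε) (π ◅◅ connected τ′P xP) (proj₁ (proj₂ e))

      -- Non-triviality: every member of P has a successor in P, for otherwise
      -- P would be the singleton of a UID without a self-loop.
      successor : ∀ {τ} → τ ∈ P → ¬ ¬ (∃ λ t → τ ⟶ₚ t)
      successor {τ} τP no-successor =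
        nontrivial (τ , singleton , τP , λ τ⟶τ → no-successor (τ , step τP τP τ⟶τ))
        where
          singleton : ∀ τ′ → τ′ ∈ P → τ′ ≡ τ
          singleton τ′ τ′P with connectedₚ τP τ′P
          ... | ε     = refl
          ... | e ◅ _ = ⊥-elim (no-successor (_ , e))

      -- Following a successor around the cycle back to τ yields a predecessor.
      predecessor : ∀ {τ} → τ ∈ P → ¬ ¬ (∃ λ m → m ⟶ₚ τ)
      predecessor τP = do
        (t , τ⟶t) ← successor τP
        pure (last-step _⟶ₚ_ τ⟶t (connectedₚ (target∈P τ⟶t) τP))

      -- In every finite model, all positions of P carry equally many values:
      -- counts never decrease along the cycles through P.
      lhs-card : ∀ {I τ τ′} → Model I → τ ∈ P → τ′ ∈ P → card I (lhs τ) ≡ card I (lhs τ′)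
      lhs-card M τP τ′P = ≤-antisym (path-card M (connected τP τ′P)) (path-card M (connected τ′P τP))

      rhs-card : ∀ {I τ} → Model I → τ ∈ P → card I (rhs τ) ≡ card I (lhs τ)
      rhs-card {I} {τ} M τP = decidable-stable (card I (rhs τ) ℕ.≟ card I (lhs τ)) do
        (t , step _ tP τ⟶t) ← successor τP
        let (l≤r , r≤l′) = edge-card M τ⟶t
        pure (≤-antisym (≤-trans r≤l′ (≤-reflexive (lhs-card M tP τP))) l≤r)

      reverse-uid : ∀ {τ} → τ ∈ P → (τ ⁻¹) ∈ uids
      reverse-uid τP = uid-converse (inΣ τP) λ I M → ≤-reflexive (rhs-card M τP)

      reverse-edge-ufd : ∀ {x S q r y} → (x ⊆ᵤ (S , q)) ⟶ₚ ((S , r) ⊆ᵤ y) → ufd S q r ∈ ufds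
      reverse-edge-ufd (step xP yP (_ , _ , _ , refl , _ , r→q)) =
        ufd-converse r→q λ I M → ≤-reflexive (trans (lhs-card M yP xP) (sym (rhs-card M xP)))

      inverse-source : ∀ {x t z} → x ⟶ₚ t → (rhs x ⊆ᵤ z) ∈ uids → (t ⁻¹) ⟶ (rhs x ⊆ᵤ z)
      inverse-source {_ ⊆ᵤ (S , q)} {.(S , r) ⊆ᵤ _} x⟶t@(step _ tP (_ , _ , r , refl , r≢q , _)) wΣ =
        edge (reverse-uid tP) wΣ (r≢q ∘ sym) (reverse-edge-ufd x⟶t)

      inverse-target : ∀ {z v w} → z ⟶ₚ v → (w ⊆ᵤ lhs v) ∈ uids → (w ⊆ᵤ lhs v) ⟶ (z ⁻¹)
      inverse-target {_ ⊆ᵤ (S , q)} {.(S , r) ⊆ᵤ _} z⟶v@(step zP _ (_ , _ , r , refl , r≢q , _)) wΣ =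
        edge wΣ (reverse-uid zP) (r≢q ∘ sym) (reverse-edge-ufd z⟶v)

      reverse-edge : ∀ {x y} → x ⟶ₚ y → (y ⁻¹) ⟶ (x ⁻¹)
      reverse-edge x⟶y = inverse-source x⟶y (reverse-uid (source∈P x⟶y))

      reverse-path : ∀ {x y} → Star _⟶ₚ_ x y → (y ⁻¹) ⟶* (x ⁻¹)
      reverse-path = gmap _⁻¹ reverse-edge ∘ Star.reverse id

      -- Two successors u, v of m with different left positions: the
      -- dependencies lhs v → rhs m → lhs u give an edge u⁻¹ ⟶ v.
      sibling-edge : ∀ {m u v} → m ⟶ₚ u → m ⟶ₚ v → lhs u ≢ lhs v → (u ⁻¹) ⟶ v
      sibling-edge {_ ⊆ᵤ (S , q)} {.(S , r₁) ⊆ᵤ _} {.(S , r₂) ⊆ᵤ _}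
        m⟶u@(step _ uP (_ , _ , r₁ , refl , _ , _)) (step _ _ (_ , vΣ , r₂ , refl , _ , r₂→q)) u≢v =
        edge (reverse-uid uP) vΣ (u≢v ∘ sym) (ufd-trans r₂→q (reverse-edge-ufd m⟶u))

      -- Two predecessors u, v of m with different right positions: the
      -- dependencies rhs v → lhs m → rhs u give an edge u ⟶ v⁻¹.
      co-sibling-edge : ∀ {u v m} → u ⟶ₚ m → v ⟶ₚ m → rhs u ≢ rhs v → u ⟶ (v ⁻¹)
      co-sibling-edge {_ ⊆ᵤ (S , q₁)} {_ ⊆ᵤ (.S , q₂)} {.(S , r) ⊆ᵤ _}
        (step _ _ (uΣ , _ , r , refl , _ , r→q₁)) v⟶m@(step vP _ (_ , _ , .r , refl , _ , _)) u≢v =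
        edge uΣ (reverse-uid vP) (u≢v ∘ sym) (ufd-trans (reverse-edge-ufd v⟶m) r→q₁)

      InverseEntersP : Set
      InverseEntersP = ∃ λ t → ∃ λ z → t ∈ P × z ∈ P × (t ⁻¹) ⟶* z

      PEntersInverse : Set
      PEntersInverse = ∃ λ t → ∃ λ z → t ∈ P × z ∈ P × t ⟶* (z ⁻¹)

      -- If travel is possible in both directions, P⁻¹ lies in the same
      -- component as P, so P is closed under inverses.
      self-inverse : InverseEntersP → PEntersInverse → ∀ {x} → x ∈ P → (x ⁻¹) ∈ P
      self-inverse (t , z , tP , zP , t⁻¹⟶*z) (t′ , z′ , t′P , z′P , t′⟶*z′⁻¹) {x} xP =
        maximal xP (forget (connectedₚ xP t′P) ◅◅ t′⟶*z′⁻¹ ◅◅ reverse-path (connectedₚ xP z′P))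
                   (reverse-path (connectedₚ tP xP) ◅◅ t⁻¹⟶*z ◅◅ forget (connectedₚ zP xP))
                   (reverse-uid xP)

      out-branching : ∀ {m u v} → m ⟶ₚ u → m ⟶ₚ v → u ≢ v → ¬ ¬ InverseEntersP
      out-branching {u = a ⊆ᵤ b} {v = a′ ⊆ᵤ c} m⟶u m⟶v u≢v with a ≟ₚ a′
      ... | no a≢a′ = pure (_ , _ , target∈P m⟶u , target∈P m⟶v , sibling-edge m⟶u m⟶v a≢a′ ◅ ε)
      ... | yes refl = do
        (t , u⟶t) ← successor (target∈P m⟶u)
        (o , v⟶o) ← successor (target∈P m⟶v)
        let bcΣ = uid-trans (reverse-uid (target∈P m⟶u)) (inΣ (target∈P m⟶v)) (λ { refl → u≢v refl })
        pure (t , o , target∈P u⟶t , target∈P v⟶o ,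
              inverse-source u⟶t bcΣ ◅ ⟶-source (edge-of v⟶o) bcΣ ◅ ε)

      in-branching : ∀ {u v m} → u ⟶ₚ m → v ⟶ₚ m → u ≢ v → ¬ ¬ PEntersInverse
      in-branching {u = a ⊆ᵤ b} {v = c ⊆ᵤ b′} u⟶m v⟶m u≢v with b ≟ₚ b′
      ... | no b≢b′ = pure (_ , _ , source∈P u⟶m , source∈P v⟶m , co-sibling-edge u⟶m v⟶m b≢b′ ◅ ε)
      ... | yes refl = do
        (t , t⟶u) ← predecessor (source∈P u⟶m)
        (z , z⟶v) ← predecessor (source∈P v⟶m)
        let acΣ = uid-trans (inΣ (source∈P u⟶m)) (reverse-uid (source∈P v⟶m)) (λ { refl → u≢v refl })
        pure (t , z , source∈P t⟶u , source∈P z⟶v ,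
              ⟶-target (edge-of t⟶u) acΣ ◅ inverse-target z⟶v acΣ ◅ ε)

      -- Composing two UIDs of P: a ⊆ c is implied, inherits the predecessors
      -- of a ⊆ b and the successors of b ⊆ c, and so lies on a cycle through P.
      compose : ∀ {a b c} → (a ⊆ᵤ b) ∈ P → (b ⊆ᵤ c) ∈ P → a ≢ c → ¬ ¬ ((a ⊆ᵤ c) ∈ P)
      compose abP bcP a≢c = do
        (m , m⟶ab) ← predecessor abP
        (o , bc⟶o) ← successor bcP
        let acΣ = uid-trans (inΣ abP) (inΣ bcP) a≢c
        pure (maximal abP (forget (connectedₚ abP (source∈P m⟶ab)) ◅◅ ⟶-target (edge-of m⟶ab) acΣ ◅ ε)
                          (⟶-source (edge-of bc⟶o) acΣ ◅ forget (connectedₚ (target∈P bc⟶o) abP))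
                          acΣ)

      -- Two UIDs of P with a common right position: both lead to the same
      -- successor s, which gives in-branching; as they are also reachable
      -- from s, some node of P branches outwards.  So P = P⁻¹.
      common-target : ∀ {a b c} → (a ⊆ᵤ b) ∈ P → (c ⊆ᵤ b) ∈ P → a ≢ c → ¬ ¬ ((b ⊆ᵤ c) ∈ P)
      common-target abP cbP a≢c = do
        (s , ab⟶s) ← successor abP
        let cb⟶s = step cbP (target∈P ab⟶s) (⟶-source (edge-of ab⟶s) (inΣ cbP))
            ab≢cb = a≢c ∘ cong lhs
            sP = target∈P ab⟶s
        p-enters ← in-branching ab⟶s cb⟶s ab≢cb
        (m , u , v , m⟶u , m⟶v , u≢v) ←
          cycle-branches _⟶ₚ_ _≟ᵤ_ ab≢cb ab⟶s cb⟶s (connectedₚ sP abP) (connectedₚ sP cbP)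
        inverse-enters ← out-branching m⟶u m⟶v u≢v
        pure (self-inverse inverse-enters p-enters cbP)

      common-source : ∀ {a b c} → (b ⊆ᵤ a) ∈ P → (b ⊆ᵤ c) ∈ P → a ≢ c → ¬ ¬ ((a ⊆ᵤ b) ∈ P)
      common-source baP bcP a≢c = do
        (m , m⟶ba) ← predecessor baP
        let m⟶bc = step (source∈P m⟶ba) bcP (⟶-target (edge-of m⟶ba) (inΣ bcP))
            ba≢bc = a≢c ∘ cong rhs
            mP = source∈P m⟶ba
        inverse-enters ← out-branching m⟶ba m⟶bc ba≢bc
        (m′ , u , v , u⟶m′ , v⟶m′ , u≢v) ←
          cycle-branches (flip _⟶ₚ_) _≟ᵤ_ ba≢bc m⟶ba m⟶bc
            (Star.reverse id (connectedₚ baP mP)) (Star.reverse id (connectedₚ bcP mP))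
        p-enters ← in-branching u⟶m′ v⟶m′ u≢v
        pure (self-inverse inverse-enters p-enters baP)

mainTheorem15 : (n : ℕ) (ar : Fin n → ℕ) (ΣU : Schema.Constraints n ar) →
    Schema.ProperUIDs n ar ΣU →
    Schema.ClosedFinImpl n ar ΣU →
    (P : List (Schema.UID n ar)) →
    Schema.IsSCC n ar ΣU P →
    Schema.NonTrivial n ar ΣU P →
    Schema.TransClosed n ar (λ τ → Schema._∈P∪P⁻¹_ n ar τ P)
mainTheorem15 n ar ΣU proper closed P scc nontrivial a b c ab bc a≢c =
  decidable-stable ((a ⊆ᵤ c) ∈? P ⊎-dec (c ⊆ᵤ a) ∈? P) (chain ab bc)
  where
    open Schema n ar
    open UnaryConstraints n ar
    open Implication.Component ΣU proper closed P scc nontrivial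
    open import Data.List.Membership.DecPropositional _≟ᵤ_ using (_∈?_)

    chain : (a ⊆ᵤ b) ∈P∪P⁻¹ P → (b ⊆ᵤ c) ∈P∪P⁻¹ P → ¬ ¬ ((a ⊆ᵤ c) ∈P∪P⁻¹ P)
    chain (inj₁ abP) (inj₁ bcP) = inj₁ <$> compose abP bcP a≢c
    chain (inj₂ baP) (inj₂ cbP) = inj₂ <$> compose cbP baP (a≢c ∘ sym)
    chain (inj₁ abP) (inj₂ cbP) = do
      bcP ← common-target abP cbP a≢c
      inj₁ <$> compose abP bcP a≢c
    chain (inj₂ baP) (inj₁ bcP) = do
      abP ← common-source baP bcP a≢c
      inj₁ <$> compose abP bcP a≢c
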